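{- Let $k\ge2$, $n\ge1$, $w\ge1$ be integers and $0\le\Delta\le\frac{n}{2(k-1)}$. If there exists a length-$n$ width-$w$ read-once branching program over alphabet $[k]$ computing $\mathsf{ApproxCount}_{k\text{ -counter}}[n,\Delta]$, then $$\Delta\ \ge\ \frac{n}{2(k-1)}-\frac{\sqrt[k]{k!}}{2(k-1)}\cdot\sqrt[k]{nw}.$$
   Context: A length-$n$ read-once branching program (ROBP) over a finite alphabet $\Sigma$ is a directed layered multigraph with layers $V_0,\dots,V_n$, $V_0=\{v_{\mathrm{start}}\}$; for $0\le i\le n-1$ each vertex of $V_i$ has $|\Sigma|$ outgoing edges into $V_{i+1}$ labeled by distinct elements of $\Sigma$; vertices of $V_n$ are labeled with outputs; every vertex is reachable by some input. An input $x\in\Sigma^n$ follows from $v_{\mathrm{start}}$ the edges labeled $x_1,\dots,x_n$ and the program outputs the label of the final vertex. Width is $\max_i|V_i|$. $\mathsf{ApproxCount}_{k\text{ -counter}}[n,\Delta]$: on input $x\in[k]^n$ output reals $(\hat S_1,\dots,\hat S_k)$ with $|\hat S_j-\#\{i:x_i=j\}|\le\Delta$ for all $j\in[k]$; a program computes it if its output is valid on every input.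
   Formalization: The error bound Δ and the program outputs $(\hat S_1,\dots,\hat S_k)$ are rational rather than real. -}

module Defs where

open import Data.Nat as ℕ using (ℕ; zero; suc; _<_; _≤_)
open import Data.Nat.Properties using (<⇒≤; ≤-refl)
open import Data.Fin using (Fin; fromℕ<; _≟_)
open import Data.List using (List; length; filter; allFin)
open import Data.Integer using (+_)
open import Data.Rational using (ℚ; _/_; 1ℚ; _*_)
open import Data.Product using (∃; _×_)
open import Relation.Binary.PropositionalEquality using (_≡_; subst; sym)

ℕtoℚ : ℕ → ℚ
ℕtoℚ n = (+ n) / 1

_^ℚ_ : ℚ → ℕ → ℚ
q ^ℚ zero = 1ℚ
q ^ℚ suc m = q * (q ^ℚ m)

occurrences : ∀ {n k} → (Fin n → Fin k) → Fin k → ℕ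
occurrences {n} x j = length (filter (λ i → x i ≟ j) (allFin n))

-- Layer i (0 ≤ i ≤ n) has vertex set Fin (size i); the edge of a vertex v in
-- layer i labelled a goes to  step i _ v a  in layer i+1 (one edge per label,
-- labels distinct).
record ROBP (n k : ℕ) (Out : Set) : Set where
  field
    size  : ℕ → ℕ
    size0 : size zero ≡ 1
    step  : (i : ℕ) → i < n → Fin (size i) → Fin k → Fin (size (suc i))
    out   : Fin (size n) → Out

  run : (Fin n → Fin k) → (i : ℕ) → i ≤ n → Fin (size i)
  run x zero    _ = subst Fin (sym size0) Fin.zero
  run x (suc i) p = step i p (run x i (<⇒≤ p)) (x (fromℕ< p))

  eval : (Fin n → Fin k) → Out
  eval x = out (run x n ≤-refl)

  AllReachable : Set
  AllReachable = ∀ (i : ℕ) (p : i ≤ n) (v : Fin (size i)) → ∃ λ x → run x i p ≡ v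

  HasWidth : ℕ → Set
  HasWidth w = (∀ i → i ≤ n → size i ≤ w) × (∃ λ i → i ≤ n × size i ≡ w)

open ROBP public

ComputesApproxCount : ∀ {n k} → ROBP n k (Fin k → ℚ) → ℚ → Set
ComputesApproxCount {n} {k} P Δ =
  ∀ (x : Fin n → Fin k) (j : Fin k) →
    Data.Rational.∣ eval P x j Data.Rational.- ℕtoℚ (occurrences x j) ∣ Data.Rational.≤ Δ

-- Let E = ⌊2Δ⌋. If inputs x and y reach the same vertex in layer i, the input that reads x before
-- position i and y from there on ends where y ends and so gets y's output; as that output is
-- Δ-accurate for both inputs, the numbers of letters j among the first i letters of x and of y
-- differ by at most E, for every j. Given c ∈ ℕᵏ with Σc + (k − 1)E ≤ n, walk from the start vertex
-- along the edge labelled j as long as some input reaching the current vertex has read fewer than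
-- c_j letters j; every c_j stays attained by some input reaching the current vertex, and with the
-- spread bound this forces such a step to start below layer n. So the walk stops at a vertex where
-- c is the componentwise minimum of the letter counts of the inputs reaching it, and distinct c give
-- distinct vertices: the (M + 1)⋯(M + k)/k! ≥ 1 + Mᵏ/k! vectors with sum at most M = n − (k − 1)E
-- are at most as many as the 1 + n·w vertices. Hence Mᵏ ≤ k!·n·w, and M ≥ n − 2(k − 1)Δ.

module Submission where

open import Defs
open import Level using (0ℓ)
open import Function using (_∘_; _⇔_; mk⇔; Equivalence)
open import Data.Empty using (⊥)
open import Data.Sum using (inj₁; inj₂)
open import Data.Product using (Σ; Σ-syntax; ∃-syntax; _×_; _,_; proj₁; proj₂)
open import Data.Bool using (true; false; if_then_else_)
open import Relation.Nullary using (¬_; Dec; yes; no; does; contradiction)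
open import Relation.Nullary.Decidable using (dec-true; dec-false; decidable-stable)
open import Relation.Nullary.Negation using (¬¬-Monad)
open import Relation.Binary.PropositionalEquality
  using (_≡_; _≢_; refl; sym; trans; cong; cong₂; subst; subst₂; module ≡-Reasoning)

open import Data.Nat as ℕ
  using (ℕ; zero; suc; _+_; _*_; _∸_; _^_; _!; _≤_; _<_; _≤′_; ≤′-refl; ≤′-step; z≤n; s≤s)
import Data.Nat.Properties as ℕ
open import Data.Nat.DivMod using (_/_; m/n*n≤m; /-monoˡ-≤; m*n/n≡m)
open import Data.Nat.Coprimality as Coprimality using (Coprime)
import Data.Nat.Solver as ℕ-Solver
open import Algebra.Properties.Semiring.Sum ℕ.+-*-semiring
  using (sum; sum-syntax; sum-cong-≗; ∑-distrib-+; sum-remove; sum-init-last; ∑-comm)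
open import Algebra.Properties.CommutativeSemigroup ℕ.+-commutativeSemigroup using (xy∙z≈xz∙y)
open import Data.Integer as ℤ using (-[1+_])
import Data.Integer.Properties as ℤ
open import Data.Rational as ℚ using (ℚ; mkℚ; 0ℚ; 1ℚ; _-_; -_; ∣_∣; *≤*)
  renaming (_+_ to _+ℚ_; _*_ to _*ℚ_; _≤_ to _≤ℚ_)
import Data.Rational.Properties as ℚ
import Data.Rational.Solver as ℚ-Solver

open import Data.Fin as Fin using (Fin; toℕ; fromℕ<; inject≤; punchIn; _≟_)
import Data.Fin.Properties as Fin
open import Data.Vec as Vec using (Vec; []; _∷_; lookup)
import Data.Vec.Properties as Vec
open import Data.List as List using (List; []; _∷_; [_]; _++_; map; length; filter; tabulate)
open import Data.List.Properties using (length-++; length-map)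
open import Data.List.Relation.Unary.All as All using (All; []; _∷_)
import Data.List.Relation.Unary.All.Properties as All
open import Data.List.Relation.Unary.AllPairs using ([]; _∷_)
open import Data.List.Relation.Unary.Unique.Propositional using (Unique)
import Data.List.Relation.Unary.Unique.Propositional.Properties as Unique
open import Data.List.Membership.Propositional using (_∈_)
open import Data.List.Membership.Propositional.Properties using (∈-map⁻; ∈-lookup)

ℕtoℚ≡mkℚ : ∀ n → ℕtoℚ n ≡ mkℚ (ℤ.+ n) 0 (Coprimality.sym (Coprimality.1-coprimeTo n))
ℕtoℚ≡mkℚ n = ℚ.normalize-coprime _

ℕtoℚ-≤-mkℚ : ∀ d {a b} .{c : Coprime a (suc b)} → ℕtoℚ d ≤ℚ mkℚ (ℤ.+ a) b c ⇔ d * suc b ≤ a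
ℕtoℚ-≤-mkℚ d {a} {b} rewrite ℕtoℚ≡mkℚ d = mk⇔
  (λ { (*≤* le) → ℤ.drop‿+≤+ (subst₂ ℤ._≤_ (sym (ℤ.pos-* d (suc b))) (ℤ.*-identityʳ (ℤ.+ a)) le) })
  (λ le → *≤* (subst₂ ℤ._≤_ (ℤ.pos-* d (suc b)) (sym (ℤ.*-identityʳ (ℤ.+ a))) (ℤ.+≤+ le)))

ℕtoℚ-mono-≤ : ∀ {a b} → a ≤ b → ℕtoℚ a ≤ℚ ℕtoℚ b
ℕtoℚ-mono-≤ {a} {b} a≤b = subst (ℕtoℚ a ≤ℚ_) (sym (ℕtoℚ≡mkℚ b))
  (Equivalence.from (ℕtoℚ-≤-mkℚ a) (subst (_≤ b) (sym (ℕ.*-identityʳ a)) a≤b))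

ℕtoℚ-cancel-≤ : ∀ {a b} → ℕtoℚ a ≤ℚ ℕtoℚ b → a ≤ b
ℕtoℚ-cancel-≤ {a} {b} le = subst (_≤ b) (ℕ.*-identityʳ a)
  (Equivalence.to (ℕtoℚ-≤-mkℚ a) (subst (ℕtoℚ a ≤ℚ_) (ℕtoℚ≡mkℚ b) le))

ℕtoℚ-nonNeg : ∀ a → 0ℚ ≤ℚ ℕtoℚ a
ℕtoℚ-nonNeg a = ℕtoℚ-mono-≤ {0} {a} z≤n

ℕtoℚ-+ : ∀ a b → ℕtoℚ (a + b) ≡ ℕtoℚ a +ℚ ℕtoℚ b
ℕtoℚ-+ a b = begin
  ℕtoℚ (a + b)
    ≡⟨ ℚ./-cong (ℤ.pos-+ a b) refl ⟩
  (ℤ.+ a ℤ.+ ℤ.+ b) ℚ./ 1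
    ≡⟨ ℚ./-cong (sym (cong₂ ℤ._+_ (ℤ.*-identityʳ (ℤ.+ a)) (ℤ.*-identityʳ (ℤ.+ b)))) refl ⟩
  (ℤ.+ a ℤ.* ℤ.+ 1 ℤ.+ ℤ.+ b ℤ.* ℤ.+ 1) ℚ./ 1
    ≡⟨ cong₂ _+ℚ_ (ℕtoℚ≡mkℚ a) (ℕtoℚ≡mkℚ b) ⟨
  ℕtoℚ a +ℚ ℕtoℚ b
    ∎
  where open ≡-Reasoning

ℕtoℚ-* : ∀ a b → ℕtoℚ (a * b) ≡ ℕtoℚ a *ℚ ℕtoℚ b
ℕtoℚ-* a b = begin
  ℕtoℚ (a * b)               ≡⟨ ℚ./-cong (ℤ.pos-* a b) refl ⟩
  (ℤ.+ a ℤ.* ℤ.+ b) ℚ./ 1    ≡⟨ cong₂ _*ℚ_ (ℕtoℚ≡mkℚ a) (ℕtoℚ≡mkℚ b) ⟨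
  ℕtoℚ a *ℚ ℕtoℚ b           ∎
  where open ≡-Reasoning

ℕtoℚ-^ : ∀ a m → ℕtoℚ (a ^ m) ≡ ℕtoℚ a ^ℚ m
ℕtoℚ-^ a zero    = refl
ℕtoℚ-^ a (suc m) = trans (ℕtoℚ-* a (a ^ m)) (cong (ℕtoℚ a *ℚ_) (ℕtoℚ-^ a m))

ℕtoℚ-∸ : ∀ {a b} → b ≤ a → ℕtoℚ (a ∸ b) ≡ ℕtoℚ a - ℕtoℚ b
ℕtoℚ-∸ {a} {b} b≤a = begin
  ℕtoℚ (a ∸ b)                        ≡⟨ solve 2 (λ d e → d := (d :+ e) :- e) refl (ℕtoℚ (a ∸ b)) (ℕtoℚ b) ⟩
  (ℕtoℚ (a ∸ b) +ℚ ℕtoℚ b) - ℕtoℚ b   ≡⟨ cong (_- ℕtoℚ b) (ℕtoℚ-+ (a ∸ b) b) ⟨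
  ℕtoℚ (a ∸ b + b) - ℕtoℚ b           ≡⟨ cong (λ c → ℕtoℚ c - ℕtoℚ b) (ℕ.m∸n+n≡m b≤a) ⟩
  ℕtoℚ a - ℕtoℚ b                     ∎
  where
  open ≡-Reasoning
  open ℚ-Solver.+-*-Solver

ℕtoℚ-∸-≤-∣-∣ : ∀ a b → ℕtoℚ (a ∸ b) ≤ℚ ∣ ℕtoℚ a - ℕtoℚ b ∣
ℕtoℚ-∸-≤-∣-∣ a b with ℕ.≤-total a b
... | inj₁ a≤b rewrite ℕ.m≤n⇒m∸n≡0 a≤b = ℚ.0≤∣p∣ _
... | inj₂ b≤a = ℚ.≤-reflexive (trans (sym (ℚ.0≤p⇒∣p∣≡p (ℕtoℚ-nonNeg (a ∸ b)))) (cong ∣_∣ (ℕtoℚ-∸ b≤a)))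

-- 0 on negative rationals.
⌊_⌋ℕ : ℚ → ℕ
⌊ mkℚ (ℤ.+ a)   b _ ⌋ℕ = a / suc b
⌊ mkℚ -[1+ _ ] _ _ ⌋ℕ = 0

⌊⌋ℕ-≤ : ∀ q → 0ℚ ≤ℚ q → ℕtoℚ ⌊ q ⌋ℕ ≤ℚ q
⌊⌋ℕ-≤ (mkℚ (ℤ.+ a)   b _) _   = Equivalence.from (ℕtoℚ-≤-mkℚ (a / suc b)) (m/n*n≤m a (suc b))
⌊⌋ℕ-≤ (mkℚ -[1+ _ ] _ _) 0≤q with () ← ℚ.nonNegative 0≤q

≤-⌊⌋ℕ : ∀ {d} q → ℕtoℚ d ≤ℚ q → d ≤ ⌊ q ⌋ℕ
≤-⌊⌋ℕ {d} (mkℚ (ℤ.+ a) b _) d≤q =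
  subst (_≤ a / suc b) (m*n/n≡m d (suc b)) (/-monoˡ-≤ (suc b) (Equivalence.to (ℕtoℚ-≤-mkℚ d) d≤q))
≤-⌊⌋ℕ {d} (mkℚ -[1+ _ ] _ _) d≤q with () ← ℚ.nonNegative (ℚ.≤-trans (ℕtoℚ-nonNeg d) d≤q)

ℕtoℚ-*-⌊⌋ℕ-≤ : ∀ a {q} → 0ℚ ≤ℚ q → ℕtoℚ (a * ⌊ q ⌋ℕ) ≤ℚ ℕtoℚ a *ℚ q
ℕtoℚ-*-⌊⌋ℕ-≤ a {q} 0≤q = subst (_≤ℚ ℕtoℚ a *ℚ q) (sym (ℕtoℚ-* a ⌊ q ⌋ℕ))
  (ℚ.*-monoˡ-≤-nonNeg (ℕtoℚ a) {{ℚ.nonNegative (ℕtoℚ-nonNeg a)}} (⌊⌋ℕ-≤ q 0≤q))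

^ℚ-nonNeg : ∀ {q} → 0ℚ ≤ℚ q → ∀ m → 0ℚ ≤ℚ q ^ℚ m
^ℚ-nonNeg 0≤q zero        = ℚ.nonNegative⁻¹ 1ℚ
^ℚ-nonNeg {q} 0≤q (suc m) = ℚ.nonNegative⁻¹ _
  {{ℚ.nonNeg*nonNeg⇒nonNeg q {{ℚ.nonNegative 0≤q}} (q ^ℚ m) {{ℚ.nonNegative (^ℚ-nonNeg 0≤q m)}}}}

^ℚ-mono-≤ : ∀ {p q} → 0ℚ ≤ℚ p → p ≤ℚ q → ∀ m → p ^ℚ m ≤ℚ q ^ℚ m
^ℚ-mono-≤ 0≤p p≤q zero            = ℚ.≤-refl
^ℚ-mono-≤ {p} {q} 0≤p p≤q (suc m) = ℚ.≤-trans
  (ℚ.*-monoʳ-≤-nonNeg (p ^ℚ m) {{ℚ.nonNegative (^ℚ-nonNeg 0≤p m)}} p≤q)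
  (ℚ.*-monoˡ-≤-nonNeg q {{ℚ.nonNegative (ℚ.≤-trans 0≤p p≤q)}} (^ℚ-mono-≤ 0≤p p≤q m))

p≤q⇒0≤q-p : ∀ {p q} → p ≤ℚ q → 0ℚ ≤ℚ q - p
p≤q⇒0≤q-p {p} {q} p≤q = subst (_≤ℚ q - p) (ℚ.+-inverseʳ p) (ℚ.+-monoˡ-≤ (- p) p≤q)

∣p-q∣≤∣r-q∣+∣r-p∣ : ∀ p q r → ∣ p - q ∣ ≤ℚ ∣ r - q ∣ +ℚ ∣ r - p ∣
∣p-q∣≤∣r-q∣+∣r-p∣ p q r = subst (λ s → ∣ s ∣ ≤ℚ ∣ r - q ∣ +ℚ ∣ r - p ∣)
  (solve 3 (λ p q r → (r :- q) :- (r :- p) := p :- q) refl p q r)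
  (ℚ.∣p-q∣≤∣p∣+∣q∣ (r - q) (r - p))
  where open ℚ-Solver.+-*-Solver

∑-mono-≤ : ∀ {m} {f g : Fin m → ℕ} → (∀ t → f t ≤ g t) → sum f ≤ sum g
∑-mono-≤ {zero}  f≤g = z≤n
∑-mono-≤ {suc m} f≤g = ℕ.+-mono-≤ (f≤g Fin.zero) (∑-mono-≤ (f≤g ∘ Fin.suc))

∑-const : ∀ m e → ∑[ t < m ] e ≡ m * e
∑-const zero    e = refl
∑-const (suc m) e = cong (e +_) (∑-const m e)

suc∑≤∑+k*e : ∀ {k} {a b : Fin (suc k) → ℕ} (j : Fin (suc k)) {e} →
             a j < b j → (∀ l → a l ≤ b l + e) → suc (sum a) ≤ sum b + k * e
suc∑≤∑+k*e {k} {a} {b} j {e} aj<bj a≤b+e = begin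
  suc (sum a)                                         ≡⟨ cong suc (sum-remove {i = j} a) ⟩
  suc (a j + ∑[ l < k ] a (punchIn j l))              ≤⟨ ℕ.+-mono-≤ aj<bj (∑-mono-≤ (a≤b+e ∘ punchIn j)) ⟩
  b j + ∑[ l < k ] (b (punchIn j l) + e)              ≡⟨ cong (b j +_) (∑-distrib-+ (b ∘ punchIn j) (λ _ → e)) ⟩
  b j + (∑[ l < k ] b (punchIn j l) + ∑[ l < k ] e)   ≡⟨ cong (λ s → b j + (∑[ l < k ] b (punchIn j l) + s)) (∑-const k e) ⟩
  b j + (∑[ l < k ] b (punchIn j l) + k * e)          ≡⟨ ℕ.+-assoc (b j) _ (k * e) ⟨
  b j + ∑[ l < k ] b (punchIn j l) + k * e            ≡⟨ cong (_+ k * e) (sum-remove {i = j} b) ⟨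
  sum b + k * e                                       ∎
  where open ℕ.≤-Reasoning

δ : ∀ {k} → Fin k → Fin k → ℕ
δ a b = if does (a ≟ b) then 1 else 0

δ-diag : ∀ {k} (a : Fin k) → δ a a ≡ 1
δ-diag a rewrite dec-true (a ≟ a) refl = refl

δ-≢ : ∀ {k} {a b : Fin k} → a ≢ b → δ a b ≡ 0
δ-≢ {a = a} {b} a≢b rewrite dec-false (a ≟ b) a≢b = refl

∑-δ : ∀ {k} (a : Fin k) → ∑[ j < k ] δ a j ≡ 1
∑-δ {suc k} a = begin
  ∑[ j < suc k ] δ a j                   ≡⟨ sum-remove {i = a} (δ a) ⟩
  δ a a + ∑[ l < k ] δ a (punchIn a l)   ≡⟨ cong₂ _+_ (δ-diag a) (sum-cong-≗ (λ l → δ-≢ (Fin.punchInᵢ≢i a l ∘ sym))) ⟩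
  1 + ∑[ l < k ] 0                       ≡⟨ cong suc (trans (∑-const k 0) (ℕ.*-zeroʳ k)) ⟩
  1                                      ∎
  where open ≡-Reasoning

length-filter-tabulate : ∀ {a p} {A : Set a} {P : A → Set p} (P? : ∀ x → Dec (P x)) {m} (f : Fin m → A) →
                         length (filter P? (tabulate f)) ≡ ∑[ t < m ] (if does (P? (f t)) then 1 else 0)
length-filter-tabulate P? {zero}  f = refl
length-filter-tabulate P? {suc m} f with does (P? (f Fin.zero))
... | true  = cong suc (length-filter-tabulate P? (f ∘ Fin.suc))
... | false = length-filter-tabulate P? (f ∘ Fin.suc)

occurrences≡∑δ : ∀ {n k} (x : Fin n → Fin k) j → occurrences x j ≡ ∑[ t < n ] δ (x t) j
occurrences≡∑δ x j = length-filter-tabulate (λ t → x t ≟ j) (λ t → t)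

-- Counting vectors with bounded sum

module _ {a} {A : Set a} where

  Unique-lookup-injective : ∀ {xs : List A} → Unique xs → ∀ {i j} → List.lookup xs i ≡ List.lookup xs j → i ≡ j
  Unique-lookup-injective (_  ∷ _) {Fin.zero}  {Fin.zero}  _  = refl
  Unique-lookup-injective (x∉ ∷ _) {Fin.zero}  {Fin.suc j} eq = contradiction eq (All.lookup x∉ (∈-lookup j))
  Unique-lookup-injective (x∉ ∷ _) {Fin.suc i} {Fin.zero}  eq = contradiction (sym eq) (All.lookup x∉ (∈-lookup i))
  Unique-lookup-injective (_  ∷ u) {Fin.suc i} {Fin.suc j} eq = cong Fin.suc (Unique-lookup-injective u eq)

  Unique⇒length≤ : ∀ {xs : List A} {m} → Unique xs → (f : ∀ {x} → x ∈ xs → Fin m) →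
                   (∀ {x y} (x∈ : x ∈ xs) (y∈ : y ∈ xs) → f x∈ ≡ f y∈ → x ≡ y) → length xs ≤ m
  Unique⇒length≤ u f f-inj =
    Fin.injective⇒≤ (λ eq → Unique-lookup-injective u (f-inj (∈-lookup _) (∈-lookup _) eq))

risingFactorial : ℕ → ℕ → ℕ
risingFactorial M zero    = 1
risingFactorial M (suc k) = suc M * risingFactorial (suc M) k

risingFactorial-snoc : ∀ M k → risingFactorial M (suc k) ≡ risingFactorial M k * (M + suc k)
risingFactorial-snoc M zero    = solve 1 (λ m → (con 1 :+ m) :* con 1 := con 1 :* (m :+ con 1)) refl M
  where open ℕ-Solver.+-*-Solver
risingFactorial-snoc M (suc k) = begin
  suc M * risingFactorial (suc M) (suc k)
    ≡⟨ cong (suc M *_) (risingFactorial-snoc (suc M) k) ⟩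
  suc M * (risingFactorial (suc M) k * (suc M + suc k))
    ≡⟨ solve 3 (λ m r q → (con 1 :+ m) :* (r :* (con 1 :+ m :+ (con 1 :+ q))) := ((con 1 :+ m) :* r) :* (m :+ (con 2 :+ q)))
               refl M (risingFactorial (suc M) k) k ⟩
  suc M * risingFactorial (suc M) k * (M + suc (suc k))
    ∎
  where
  open ≡-Reasoning
  open ℕ-Solver.+-*-Solver

risingFactorial-pascal : ∀ M k → suc k * risingFactorial (suc M) k + risingFactorial M (suc k)
                                 ≡ risingFactorial (suc M) (suc k)
risingFactorial-pascal M k = begin
  suc k * r + suc M * r   ≡⟨ ℕ.*-distribʳ-+ r (suc k) (suc M) ⟨
  (suc k + suc M) * r     ≡⟨ ℕ.*-comm (suc k + suc M) r ⟩
  r * (suc k + suc M)     ≡⟨ cong (r *_) (ℕ.+-comm (suc k) (suc M)) ⟩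
  r * (suc M + suc k)     ≡⟨ risingFactorial-snoc (suc M) k ⟨
  risingFactorial (suc M) (suc k) ∎
  where
  open ≡-Reasoning
  r : ℕ
  r = risingFactorial (suc M) k

pow+factorial≤risingFactorial : ∀ M k → M ^ suc k + suc k ! ≤ risingFactorial M (suc k)
pow+factorial≤risingFactorial M zero    =
  ℕ.≤-reflexive (solve 1 (λ m → m :* con 1 :+ con 1 := (con 1 :+ m) :* con 1) refl M)
  where open ℕ-Solver.+-*-Solver
pow+factorial≤risingFactorial M (suc k) = begin
  M * p + s * f                       ≤⟨ ℕ.m≤m+n (M * p + s * f) (p * s + f * M) ⟩
  (M * p + s * f) + (p * s + f * M)   ≡⟨ solve 4 (λ m p f s → (m :* p :+ s :* f) :+ (p :* s :+ f :* m) := (p :+ f) :* (m :+ s))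
                                               refl M p f s ⟩
  (p + f) * (M + s)                   ≤⟨ ℕ.*-monoˡ-≤ (M + s) (pow+factorial≤risingFactorial M k) ⟩
  risingFactorial M (suc k) * (M + s) ≡⟨ risingFactorial-snoc M (suc k) ⟨
  risingFactorial M (suc (suc k))     ∎
  where
  open ℕ.≤-Reasoning
  open ℕ-Solver.+-*-Solver
  p f s : ℕ
  p = M ^ suc k
  f = suc k !
  s = suc (suc k)

incHead : ∀ {k} → Vec ℕ (suc k) → Vec ℕ (suc k)
incHead (a ∷ c) = suc a ∷ c

boundedVectors : (k M : ℕ) → List (Vec ℕ k)
boundedVectors zero    M       = [ [] ]
boundedVectors (suc k) zero    = map (0 ∷_) (boundedVectors k zero)
boundedVectors (suc k) (suc M) = map (0 ∷_) (boundedVectors k (suc M)) ++ map incHead (boundedVectors (suc k) M)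

boundedVectors-sum≤ : ∀ k M → All (λ c → ∑[ j < k ] lookup c j ≤ M) (boundedVectors k M)
boundedVectors-sum≤ zero    M       = z≤n ∷ []
boundedVectors-sum≤ (suc k) zero    = All.map⁺ (boundedVectors-sum≤ k zero)
boundedVectors-sum≤ (suc k) (suc M) = All.++⁺ (All.map⁺ (boundedVectors-sum≤ k (suc M)))
  (All.map⁺ (All.map (λ {c} → incHead-sum≤ {c}) (boundedVectors-sum≤ (suc k) M)))
  where
  incHead-sum≤ : ∀ {c} → ∑[ j < suc k ] lookup c j ≤ M → ∑[ j < suc k ] lookup (incHead c) j ≤ suc M
  incHead-sum≤ {_ ∷ _} = s≤s

boundedVectors-unique : ∀ k M → Unique (boundedVectors k M)
boundedVectors-unique zero    M       = [] ∷ []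
boundedVectors-unique (suc k) zero    = Unique.map⁺ Vec.∷-injectiveʳ (boundedVectors-unique k zero)
boundedVectors-unique (suc k) (suc M) =
  Unique.++⁺ (Unique.map⁺ Vec.∷-injectiveʳ (boundedVectors-unique k (suc M)))
             (Unique.map⁺ incHead-injective (boundedVectors-unique (suc k) M))
             heads-differ
  where
  incHead-injective : ∀ {c d : Vec ℕ (suc k)} → incHead c ≡ incHead d → c ≡ d
  incHead-injective {_ ∷ _} {_ ∷ _} refl = refl
  heads-differ : ∀ {c} → c ∈ map (0 ∷_) (boundedVectors k (suc M)) × c ∈ map incHead (boundedVectors (suc k) M) → ⊥
  heads-differ (c∈ , d∈) with ∈-map⁻ (0 ∷_) c∈ | ∈-map⁻ incHead d∈
  ... | _ , _ , refl | _ ∷ _ , _ , ()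

factorial*length-boundedVectors : ∀ k M → k ! * length (boundedVectors k M) ≡ risingFactorial M k
factorial*length-boundedVectors zero    M       = refl
factorial*length-boundedVectors (suc k) zero    = begin
  suc k ! * length (map (0 ∷_) (boundedVectors k zero))  ≡⟨ cong (suc k ! *_) (length-map (0 ∷_) (boundedVectors k zero)) ⟩
  suc k * k ! * length (boundedVectors k zero)            ≡⟨ ℕ.*-assoc (suc k) (k !) _ ⟩
  suc k * (k ! * length (boundedVectors k zero))          ≡⟨ cong (suc k *_) (factorial*length-boundedVectors k zero) ⟩
  suc k * risingFactorial 0 k                             ≡⟨ ℕ.*-comm (suc k) (risingFactorial 0 k) ⟩
  risingFactorial 0 k * suc k                             ≡⟨ risingFactorial-snoc 0 k ⟨
  risingFactorial 0 (suc k)                               ∎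
  where open ≡-Reasoning
factorial*length-boundedVectors (suc k) (suc M) = begin
  suc k ! * length (map (0 ∷_) low ++ map incHead high)     ≡⟨ cong (suc k ! *_) split ⟩
  suc k * k ! * (length low + length high)                  ≡⟨ solve 4 (λ a f x y → ((con 1 :+ a) :* f) :* (x :+ y)
                                                                   := (con 1 :+ a) :* (f :* x) :+ ((con 1 :+ a) :* f) :* y)
                                                                 refl k (k !) (length low) (length high) ⟩
  suc k * (k ! * length low) + suc k ! * length high        ≡⟨ cong₂ (λ a b → suc k * a + b)
                                                                 (factorial*length-boundedVectors k (suc M))
                                                                 (factorial*length-boundedVectors (suc k) M) ⟩
  suc k * risingFactorial (suc M) k + risingFactorial M (suc k) ≡⟨ risingFactorial-pascal M k ⟩
  risingFactorial (suc M) (suc k)                           ∎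
  where
  open ≡-Reasoning
  open ℕ-Solver.+-*-Solver
  low : List (Vec ℕ k)
  low  = boundedVectors k (suc M)
  high : List (Vec ℕ (suc k))
  high = boundedVectors (suc k) M
  split : length (map (0 ∷_) low ++ map incHead high) ≡ length low + length high
  split = trans (length-++ (map (0 ∷_) low)) (cong₂ _+_ (length-map (0 ∷_) low) (length-map incHead high))

-- Prefix counts of words

≤-toℕ-fromℕ< : ∀ {i n} (i<n : i < n) → i ≤ toℕ (fromℕ< i<n)
≤-toℕ-fromℕ< i<n = ℕ.≤-reflexive (sym (Fin.toℕ-fromℕ< i<n))

module _ {n k : ℕ} where

  prefixCount : (Fin n → Fin k) → (i : ℕ) → .(i ≤ n) → Fin k → ℕ
  prefixCount x i i≤n j = ∑[ t < i ] δ (x (inject≤ t i≤n)) j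

  prefixCount-full : ∀ x j → prefixCount x n ℕ.≤-refl j ≡ occurrences x j
  prefixCount-full x j =
    trans (sum-cong-≗ (λ t → cong (λ s → δ (x s) j) (Fin.inject≤-refl t _))) (sym (occurrences≡∑δ x j))

  prefixCount-suc : ∀ x {i} (i<n : i < n) j →
                    prefixCount x (suc i) i<n j ≡ prefixCount x i (ℕ.<⇒≤ i<n) j + δ (x (fromℕ< i<n)) j
  prefixCount-suc x {i} i<n j = trans (sum-init-last (λ t → δ (x (inject≤ t i<n)) j))
    (cong₂ (λ a b → a + δ (x b) j)
           (sum-cong-≗ (λ t → cong (λ s → δ (x s) j) (Fin.toℕ-injective (toℕ-init t))))
           (Fin.toℕ-injective toℕ-last))
    where
    toℕ-init : ∀ t → toℕ (inject≤ (Fin.inject₁ t) i<n) ≡ toℕ (inject≤ t (ℕ.<⇒≤ i<n))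
    toℕ-init t = trans (Fin.toℕ-inject≤ _ i<n) (trans (Fin.toℕ-inject₁ t) (sym (Fin.toℕ-inject≤ t _)))
    toℕ-last : toℕ (inject≤ (Fin.fromℕ i) i<n) ≡ toℕ (fromℕ< i<n)
    toℕ-last = trans (Fin.toℕ-inject≤ _ i<n) (trans (Fin.toℕ-fromℕ i) (sym (Fin.toℕ-fromℕ< i<n)))

  prefixCount-agree : ∀ {x y i} (i≤n : i ≤ n) → (∀ t → toℕ t < i → x t ≡ y t) → ∀ j →
                      prefixCount x i i≤n j ≡ prefixCount y i i≤n j
  prefixCount-agree {i = i} i≤n x≡y j = sum-cong-≗ λ t →
    cong (λ a → δ a j) (x≡y (inject≤ t i≤n) (subst (_< i) (sym (Fin.toℕ-inject≤ t i≤n)) (Fin.toℕ<n t)))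

  ∑-prefixCount : ∀ x {i} (i≤n : i ≤ n) → ∑[ j < k ] prefixCount x i i≤n j ≡ i
  ∑-prefixCount x {i} i≤n = begin
    ∑[ j < k ] ∑[ t < i ] δ (x (inject≤ t i≤n)) j   ≡⟨ ∑-comm (λ j t → δ (x (inject≤ t i≤n)) j) ⟩
    ∑[ t < i ] ∑[ j < k ] δ (x (inject≤ t i≤n)) j   ≡⟨ sum-cong-≗ (λ t → ∑-δ (x (inject≤ t i≤n))) ⟩
    ∑[ t < i ] 1                                    ≡⟨ trans (∑-const i 1) (ℕ.*-identityʳ i) ⟩
    i                                               ∎
    where open ≡-Reasoning

  splice : (Fin n → Fin k) → (Fin n → Fin k) → ℕ → Fin n → Fin k
  splice x y i t = if does (toℕ t ℕ.<? i) then x t else y t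

  splice-< : ∀ x y {i} t → toℕ t < i → splice x y i t ≡ x t
  splice-< x y {i} t t<i rewrite dec-true (toℕ t ℕ.<? i) t<i = refl

  splice-≥ : ∀ x y {i} t → i ≤ toℕ t → splice x y i t ≡ y t
  splice-≥ x y {i} t i≤t rewrite dec-false (toℕ t ℕ.<? i) (ℕ.≤⇒≯ i≤t) = refl

  prefixCount-suffix : ∀ {x y i} .(i≤n : i ≤ n) → (∀ t → i ≤ toℕ t → x t ≡ y t) →
                       ∀ {l} → i ≤′ l → (l≤n : l ≤ n) → ∀ j →
                       prefixCount x l l≤n j + prefixCount y i i≤n j ≡ prefixCount y l l≤n j + prefixCount x i i≤n j
  prefixCount-suffix {x} {y} {i} i≤n x≡y ≤′-refl l≤n j = ℕ.+-comm (prefixCount x i i≤n j) _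
  prefixCount-suffix {x} {y} {i} i≤n x≡y (≤′-step {l} i≤′l) l<n j = begin
    prefixCount x (suc l) l<n j + pyi                      ≡⟨ cong (_+ pyi) (prefixCount-suc x l<n j) ⟩
    prefixCount x l l≤n j + δ (x (fromℕ< l<n)) j + pyi    ≡⟨ xy∙z≈xz∙y (prefixCount x l l≤n j) _ _ ⟩
    prefixCount x l l≤n j + pyi + δ (x (fromℕ< l<n)) j    ≡⟨ cong₂ _+_ (prefixCount-suffix i≤n x≡y i≤′l l≤n j)
                                                                       (cong (λ a → δ a j) (x≡y (fromℕ< l<n) i≤l)) ⟩
    prefixCount y l l≤n j + pxi + δ (y (fromℕ< l<n)) j    ≡⟨ xy∙z≈xz∙y (prefixCount y l l≤n j) _ _ ⟩
    prefixCount y l l≤n j + δ (y (fromℕ< l<n)) j + pxi    ≡⟨ cong (_+ pxi) (prefixCount-suc y l<n j) ⟨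
    prefixCount y (suc l) l<n j + pxi                      ∎
    where
    open ≡-Reasoning
    pxi pyi : ℕ
    pxi = prefixCount x i i≤n j
    pyi = prefixCount y i i≤n j
    l≤n : l ≤ n
    l≤n = ℕ.<⇒≤ l<n
    i≤l : i ≤ toℕ (fromℕ< l<n)
    i≤l = ℕ.≤-trans (ℕ.≤′⇒≤ i≤′l) (≤-toℕ-fromℕ< l<n)

  occurrences-splice : ∀ x y {i} (i≤n : i ≤ n) j →
                       occurrences (splice x y i) j + prefixCount y i i≤n j ≡ occurrences y j + prefixCount x i i≤n j
  occurrences-splice x y {i} i≤n j = begin
    occurrences (splice x y i) j + prefixCount y i i≤n j
      ≡⟨ cong (_+ prefixCount y i i≤n j) (prefixCount-full (splice x y i) j) ⟨
    prefixCount (splice x y i) n ℕ.≤-refl j + prefixCount y i i≤n j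
      ≡⟨ prefixCount-suffix i≤n (splice-≥ x y) (ℕ.≤⇒≤′ i≤n) ℕ.≤-refl j ⟩
    prefixCount y n ℕ.≤-refl j + prefixCount (splice x y i) i i≤n j
      ≡⟨ cong₂ _+_ (prefixCount-full y j) (prefixCount-agree i≤n (splice-< x y) j) ⟩
    occurrences y j + prefixCount x i i≤n j
      ∎
    where open ≡-Reasoning

  prefixCount-extend : ∀ x a {i} (i<n : i < n) j →
                       prefixCount (splice x (λ _ → a) i) (suc i) i<n j ≡ prefixCount x i (ℕ.<⇒≤ i<n) j + δ a j
  prefixCount-extend x a {i} i<n j = trans (prefixCount-suc (splice x (λ _ → a) i) i<n j)
    (cong₂ _+_ (prefixCount-agree (ℕ.<⇒≤ i<n) (splice-< x (λ _ → a)) j)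
               (cong (λ b → δ b j) (splice-≥ x (λ _ → a) (fromℕ< i<n) (≤-toℕ-fromℕ< i<n))))

  prefixCount-extend-≡ : ∀ x a {i} (i<n : i < n) →
                         prefixCount (splice x (λ _ → a) i) (suc i) i<n a ≡ suc (prefixCount x i (ℕ.<⇒≤ i<n) a)
  prefixCount-extend-≡ x a {i} i<n =
    trans (prefixCount-extend x a i<n a) (trans (cong (pxa +_) (δ-diag a)) (ℕ.+-comm pxa 1))
    where
    pxa : ℕ
    pxa = prefixCount x i (ℕ.<⇒≤ i<n) a

  prefixCount-extend-≢ : ∀ x {a l} → a ≢ l → ∀ {i} (i<n : i < n) →
                         prefixCount (splice x (λ _ → a) i) (suc i) i<n l ≡ prefixCount x i (ℕ.<⇒≤ i<n) l
  prefixCount-extend-≢ x {a} {l} a≢l {i} i<n =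
    trans (prefixCount-extend x a i<n l) (trans (cong (pxl +_) (δ-≢ a≢l)) (ℕ.+-identityʳ pxl))
    where
    pxl : ℕ
    pxl = prefixCount x i (ℕ.<⇒≤ i<n) l

module _ {n k : ℕ} {Out : Set} (P : ROBP n k Out) where

  run-irrelevant : ∀ x {i} (p q : i ≤ n) → run P x i p ≡ run P x i q
  run-irrelevant x {i} p q = cong (run P x i) (ℕ.≤-irrelevant p q)

  run-agree : ∀ {x y i} (i≤n : i ≤ n) → (∀ t → toℕ t < i → x t ≡ y t) → run P x i i≤n ≡ run P y i i≤n
  run-agree {i = zero}  _   _   = refl
  run-agree {i = suc i} i<n x≡y = cong₂ (step P i i<n)
    (run-agree (ℕ.<⇒≤ i<n) (λ t t<i → x≡y t (ℕ.m<n⇒m<1+n t<i)))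
    (x≡y (fromℕ< i<n) (s≤s (ℕ.≤-reflexive (Fin.toℕ-fromℕ< i<n))))

  run-suffix : ∀ {x y i} (i≤n : i ≤ n) → run P x i i≤n ≡ run P y i i≤n → (∀ t → i ≤ toℕ t → x t ≡ y t) →
               ∀ {l} → i ≤′ l → (l≤n : l ≤ n) → run P x l l≤n ≡ run P y l l≤n
  run-suffix {x} {y} i≤n same _ ≤′-refl l≤n =
    trans (run-irrelevant x l≤n i≤n) (trans same (run-irrelevant y i≤n l≤n))
  run-suffix i≤n same x≡y (≤′-step {l} i≤′l) l<n = cong₂ (step P l l<n)
    (run-suffix i≤n same x≡y i≤′l (ℕ.<⇒≤ l<n))
    (x≡y (fromℕ< l<n) (ℕ.≤-trans (ℕ.≤′⇒≤ i≤′l) (≤-toℕ-fromℕ< l<n)))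

  eval-splice : ∀ x y {i} (i≤n : i ≤ n) → run P x i i≤n ≡ run P y i i≤n → eval P (splice x y i) ≡ eval P y
  eval-splice x y i≤n same = cong (out P)
    (run-suffix i≤n (trans (run-agree i≤n (splice-< x y)) same) (splice-≥ x y) (ℕ.≤⇒≤′ i≤n) ℕ.≤-refl)

  run-extend : ∀ {x i i≤n v} a (i<n : i < n) → run P x i i≤n ≡ v →
               run P (splice x (λ _ → a) i) (suc i) i<n ≡ step P i i<n v a
  run-extend {x} {i} {i≤n} a i<n x→v = cong₂ (step P i i<n)
    (trans (run-agree (ℕ.<⇒≤ i<n) (splice-< x (λ _ → a))) (trans (run-irrelevant x _ i≤n) x→v))
    (splice-≥ x (λ _ → a) (fromℕ< i<n) (≤-toℕ-fromℕ< i<n))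

-- Vertices with a prescribed minimal count vector

module _ {n k : ℕ} {Out : Set} (P : ROBP n (suc k) Out) (E : ℕ)
         (spread : ∀ {x y i} (i≤n : i ≤ n) → run P x i i≤n ≡ run P y i i≤n →
                   ∀ j → prefixCount x i i≤n j ≤ prefixCount y i i≤n j + E) where

  Vertex : Set
  Vertex = Σ[ i ∈ ℕ ] Σ[ i≤n ∈ i ≤ n ] Fin (size P i)

  Witnessed : (i : ℕ) (i≤n : i ≤ n) → Fin (size P i) → Vec ℕ (suc k) → Set
  Witnessed i i≤n v c = ∀ j → ∃[ x ] run P x i i≤n ≡ v × prefixCount x i i≤n j ≤ lookup c j

  IsMinCount : Vertex → Vec ℕ (suc k) → Set
  IsMinCount (i , i≤n , v) c =
    (∀ x → run P x i i≤n ≡ v → ∀ j → lookup c j ≤ prefixCount x i i≤n j) × Witnessed i i≤n v c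

  witnessed-bound : ∀ {i i≤n v} c {x j} → Witnessed i i≤n v c → run P x i i≤n ≡ v →
                    prefixCount x i i≤n j < lookup c j → suc i ≤ ∑[ l < suc k ] lookup c l + k * E
  witnessed-bound {i} {i≤n} c {x} {j} wit x→v x<c =
    subst (λ s → suc s ≤ _) (∑-prefixCount x i≤n) (suc∑≤∑+k*e j x<c below)
    where
    below : ∀ l → prefixCount x i i≤n l ≤ lookup c l + E
    below l with y , y→v , y≤c ← wit l = ℕ.≤-trans (spread i≤n (trans x→v (sym y→v)) l) (ℕ.+-monoˡ-≤ E y≤c)

  witnessed-step : ∀ {i i≤n v} c {x j} (i<n : i < n) → Witnessed i i≤n v c → run P x i i≤n ≡ v →
                   prefixCount x i i≤n j < lookup c j → Witnessed (suc i) i<n (step P i i<n v j) c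
  witnessed-step c {x} {j} i<n wit x→v x<c l with j ≟ l
  ... | yes refl = _ , run-extend P j i<n x→v , ℕ.≤-trans (ℕ.≤-reflexive (prefixCount-extend-≡ x j i<n)) x<c
  ... | no j≢l with y , y→v , y≤c ← wit l =
    _ , run-extend P j i<n y→v , ℕ.≤-trans (ℕ.≤-reflexive (prefixCount-extend-≢ y j≢l i<n)) y≤c

  module _ (c : Vec ℕ (suc k)) (fits : ∑[ l < suc k ] lookup c l + k * E ≤ n) where

    private
      walk : ¬ (∃[ u ] IsMinCount u c) → ∀ d {i} (i≤n : i ≤ n) → d + i ≡ n → ∀ v → Witnessed i i≤n v c → ⊥
      walk ¬min d {i} i≤n d+i≡n v wit = ¬min ((i , i≤n , v) , minimal , wit)
        where
        continue : ∀ d → d + i ≡ n → (i<n : i < n) → ∀ {v′} → Witnessed (suc i) i<n v′ c → ⊥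
        continue zero    i≡n     i<n _    = ℕ.<-irrefl i≡n i<n
        continue (suc d) d+1+i≡n i<n wit′ = walk ¬min d i<n (trans (ℕ.+-suc d i) d+1+i≡n) _ wit′
        minimal : ∀ x → run P x i i≤n ≡ v → ∀ j → lookup c j ≤ prefixCount x i i≤n j
        minimal x x→v j = ℕ.≮⇒≥ λ x<c →
          continue d d+i≡n (ℕ.≤-trans (witnessed-bound c wit x→v x<c) fits) (witnessed-step c _ wit x→v x<c)

    -- Minimality at a vertex quantifies over all inputs and is not decided here, so the walk only
    -- refutes the absence of a minimal vertex; this suffices, as it is used for a decidable goal.
    minCount-exists : ¬ ¬ (∃[ u ] IsMinCount u c)
    minCount-exists ¬min = walk ¬min n z≤n (ℕ.+-identityʳ n) (run P input₀ 0 z≤n) (λ _ → input₀ , refl , z≤n)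
      where
      input₀ : Fin n → Fin (suc k)
      input₀ _ = Fin.zero

  minCount-unique : ∀ {u c d} → IsMinCount u c → IsMinCount u d → c ≡ d
  minCount-unique {c = c} {d} (c≤ , c-wit) (d≤ , d-wit) = begin
    c                        ≡⟨ Vec.tabulate∘lookup c ⟨
    Vec.tabulate (lookup c)  ≡⟨ Vec.tabulate-cong same ⟩
    Vec.tabulate (lookup d)  ≡⟨ Vec.tabulate∘lookup d ⟩
    d                        ∎
    where
    open ≡-Reasoning
    same : ∀ j → lookup c j ≡ lookup d j
    same j with x , x→v , x≤c ← c-wit j | y , y→v , y≤d ← d-wit j =
      ℕ.≤-antisym (ℕ.≤-trans (c≤ y y→v j) y≤d) (ℕ.≤-trans (d≤ x x→v j) x≤c)

  module _ {w : ℕ} (size≤w : ∀ i → i ≤ n → size P i ≤ w) where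

    vertexCode : Vertex → Fin (suc (n * w))
    vertexCode (zero  , _   , _) = Fin.zero
    vertexCode (suc i , i<n , v) = Fin.suc (Fin.combine (fromℕ< i<n) (inject≤ v (size≤w (suc i) i<n)))

    vertexCode-injective : ∀ u u′ → vertexCode u ≡ vertexCode u′ → u ≡ u′
    vertexCode-injective (zero , p , v) (zero , p′ , v′) _ =
      cong₂ (λ p v → zero , p , v) (ℕ.≤-irrelevant p p′) (Fin-one-point (size0 P) v v′)
      where
      Fin-one-point : ∀ {m} → m ≡ 1 → (a b : Fin m) → a ≡ b
      Fin-one-point refl Fin.zero Fin.zero = refl
    vertexCode-injective (suc i , p , v) (suc i′ , p′ , v′) eq
      with i≡i′ , v≡v′ ← Fin.combine-injective _ _ _ _ (Fin.suc-injective eq)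
      with refl ← Fin.fromℕ<-injective i i′ p p′ i≡i′ =
      cong₂ (λ p v → suc i , p , v) (ℕ.≤-irrelevant p p′) (Fin.inject≤-injective _ _ v v′ v≡v′)

    length-boundedVectors≤ : ∀ M → M + k * E ≤ n → length (boundedVectors (suc k) M) ≤ suc (n * w)
    length-boundedVectors≤ M fits = decidable-stable (_ ℕ.≤? _) λ ≰ →
      All.mapM 0ℓ ¬¬-Monad (λ {c} ∑c≤M → minCount-exists c (ℕ.≤-trans (ℕ.+-monoˡ-≤ (k * E) ∑c≤M) fits))
                           (boundedVectors-sum≤ (suc k) M)
        λ mins → ≰ (Unique⇒length≤ (boundedVectors-unique (suc k) M)
                     (λ c∈ → vertexCode (proj₁ (All.lookup mins c∈)))
                     (λ {c} c∈ d∈ eq → minCount-unique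
                        (subst (λ u → IsMinCount u c) (vertexCode-injective _ _ eq) (proj₂ (All.lookup mins c∈)))
                        (proj₂ (All.lookup mins d∈))))

    M^k≤k!*n*w : ∀ M → M + k * E ≤ n → M ^ suc k ≤ suc k ! * n * w
    M^k≤k!*n*w M fits = ℕ.+-cancelˡ-≤ (suc k !) _ _ (begin
      suc k ! + M ^ suc k                          ≡⟨ ℕ.+-comm (suc k !) (M ^ suc k) ⟩
      M ^ suc k + suc k !                          ≤⟨ pow+factorial≤risingFactorial M k ⟩
      risingFactorial M (suc k)                    ≡⟨ factorial*length-boundedVectors (suc k) M ⟨
      suc k ! * length (boundedVectors (suc k) M)  ≤⟨ ℕ.*-monoʳ-≤ (suc k !) (length-boundedVectors≤ M fits) ⟩
      suc k ! * suc (n * w)                        ≡⟨ ℕ.*-suc (suc k !) (n * w) ⟩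
      suc k ! + suc k ! * (n * w)                  ≡⟨ cong (suc k ! +_) (ℕ.*-assoc (suc k !) n w) ⟨
      suc k ! + suc k ! * n * w                    ∎)
      where open ℕ.≤-Reasoning

module _ {n k : ℕ} (P : ROBP n k (Fin k → ℚ)) {Δ : ℚ} (computes : ComputesApproxCount P Δ) where

  prefixCount-spread : ∀ {x y i} (i≤n : i ≤ n) → run P x i i≤n ≡ run P y i i≤n → ∀ j →
                       prefixCount x i i≤n j ≤ prefixCount y i i≤n j + ⌊ Δ +ℚ Δ ⌋ℕ
  prefixCount-spread {x} {y} {i} i≤n same j = ℕ.≤-trans (ℕ.m≤n+m∸n a b) (ℕ.+-monoʳ-≤ b gap≤⌊2Δ⌋)
    where
    a b oz oy : ℕ
    a  = prefixCount x i i≤n j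
    b  = prefixCount y i i≤n j
    oz = occurrences (splice x y i) j
    oy = occurrences y j
    gap : a ∸ b ≡ oz ∸ oy
    gap = begin
      a ∸ b                ≡⟨ ℕ.[m+n]∸[m+o]≡n∸o oy a b ⟨
      (oy + a) ∸ (oy + b)  ≡⟨ cong (_∸ (oy + b)) (occurrences-splice x y i≤n j) ⟨
      (oz + b) ∸ (oy + b)  ≡⟨ cong₂ _∸_ (ℕ.+-comm oz b) (ℕ.+-comm oy b) ⟩
      (b + oz) ∸ (b + oy)  ≡⟨ ℕ.[m+n]∸[m+o]≡n∸o b oz oy ⟩
      oz ∸ oy              ∎
      where open ≡-Reasoning
    gap≤2Δ : ℕtoℚ (oz ∸ oy) ≤ℚ Δ +ℚ Δ
    gap≤2Δ = begin
      ℕtoℚ (oz ∸ oy)                                         ≤⟨ ℕtoℚ-∸-≤-∣-∣ oz oy ⟩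
      ∣ ℕtoℚ oz - ℕtoℚ oy ∣                                  ≤⟨ ∣p-q∣≤∣r-q∣+∣r-p∣ (ℕtoℚ oz) (ℕtoℚ oy) (eval P y j) ⟩
      ∣ eval P y j - ℕtoℚ oy ∣ +ℚ ∣ eval P y j - ℕtoℚ oz ∣   ≤⟨ ℚ.+-mono-≤ (computes y j) splice-accurate ⟩
      Δ +ℚ Δ                                                 ∎
      where
      open ℚ.≤-Reasoning
      splice-accurate : ∣ eval P y j - ℕtoℚ oz ∣ ≤ℚ Δ
      splice-accurate =
        subst (λ f → ∣ f j - ℕtoℚ oz ∣ ≤ℚ Δ) (eval-splice P x y i≤n same) (computes (splice x y i) j)
    gap≤⌊2Δ⌋ : a ∸ b ≤ ⌊ Δ +ℚ Δ ⌋ℕ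
    gap≤⌊2Δ⌋ = ≤-⌊⌋ℕ (Δ +ℚ Δ) (subst (λ d → ℕtoℚ d ≤ℚ Δ +ℚ Δ) (sym gap) gap≤2Δ)

corollary4p8 : (k n w : ℕ) → 2 ≤ k → 1 ≤ n → 1 ≤ w → (Δ : ℚ) →
    0ℚ ≤ℚ Δ → ℕtoℚ 2 *ℚ ℕtoℚ (k ∸ 1) *ℚ Δ ≤ℚ ℕtoℚ n →
    Σ (ROBP n k (Fin k → ℚ)) (λ P → AllReachable P × HasWidth P w × ComputesApproxCount P Δ) →
    (ℕtoℚ n - ℕtoℚ 2 *ℚ ℕtoℚ (k ∸ 1) *ℚ Δ) ^ℚ k ≤ℚ ℕtoℚ (k !) *ℚ ℕtoℚ n *ℚ ℕtoℚ w
corollary4p8 (suc k) n w (s≤s _) _ _ Δ 0≤Δ B≤n (P , _ , (size≤w , _) , computes) = begin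
  (ℕtoℚ n - B) ^ℚ suc k           ≤⟨ ^ℚ-mono-≤ (p≤q⇒0≤q-p B≤n) n-B≤M (suc k) ⟩
  ℕtoℚ M ^ℚ suc k                 ≡⟨ ℕtoℚ-^ M (suc k) ⟨
  ℕtoℚ (M ^ suc k)                ≤⟨ ℕtoℚ-mono-≤ (M^k≤k!*n*w P E (prefixCount-spread P computes) size≤w M M+kE≤n) ⟩
  ℕtoℚ (suc k ! * n * w)          ≡⟨ trans (ℕtoℚ-* (suc k ! * n) w) (cong (_*ℚ ℕtoℚ w) (ℕtoℚ-* (suc k !) n)) ⟩
  ℕtoℚ (suc k !) *ℚ ℕtoℚ n *ℚ ℕtoℚ w  ∎
  where
  open ℚ.≤-Reasoning
  B : ℚ
  B = ℕtoℚ 2 *ℚ ℕtoℚ k *ℚ Δ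
  E M : ℕ
  E = ⌊ Δ +ℚ Δ ⌋ℕ
  M = n ∸ k * E
  kE≤B : ℕtoℚ (k * E) ≤ℚ B
  kE≤B = subst (ℕtoℚ (k * E) ≤ℚ_) (solve 2 (λ K D → K :* (D :+ D) := con (ℕtoℚ 2) :* K :* D) refl (ℕtoℚ k) Δ)
               (ℕtoℚ-*-⌊⌋ℕ-≤ k (ℚ.+-mono-≤ 0≤Δ 0≤Δ))
    where open ℚ-Solver.+-*-Solver
  kE≤n : k * E ≤ n
  kE≤n = ℕtoℚ-cancel-≤ (ℚ.≤-trans kE≤B B≤n)
  M+kE≤n : M + k * E ≤ n
  M+kE≤n = ℕ.≤-reflexive (ℕ.m∸n+n≡m kE≤n)
  n-B≤M : ℕtoℚ n - B ≤ℚ ℕtoℚ M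
  n-B≤M = subst (ℕtoℚ n - B ≤ℚ_) (sym (ℕtoℚ-∸ kE≤n)) (ℚ.+-monoʳ-≤ (ℕtoℚ n) (ℚ.neg-antimono-≤ kE≤B))
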